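{- Let $\Lambda$ be a ring and let $\mathcal{F}$ be a homological coefficient system of $\Lambda$-modules on the Bruhat–Tits tree $X$ of $\mathrm{PGL}_2(F)$ such that for every edge $\tau\in X^1$ and every vertex $x\in\tau$ the transition map $r^{\tau}_x:\mathcal{F}(\tau)\to\mathcal{F}(x)$ is injective. Then for every vertex $y\in X^0$ the natural map $\mathcal{F}(y)\to H_0(X,\mathcal{F})$ is injective. In particular, if $H_0(X,\mathcal{F})=0$, then $\mathcal{F}=0$ (i.e. $\mathcal{F}(\tau)=0$ for all vertices and edges $\tau$).
   Context: $F$ is a non-archimedean local field with finite residue field of characteristic $p>0$. $X$ denotes the Bruhat–Tits tree of $\mathrm{PGL}_2(F)$, with vertex set $X^0$ and edge set $X^1$; an edge is identified with its two-element set of vertices. A homological coefficient system $\mathcal{F}$ of $\Lambda$-modules on $X$ consists of a $\Lambda$-module $\mathcal{F}(\tau)$ for every vertex and every edge $\tau$, and a $\Lambda$-linear map $r^{\tau}_x:\mathcal{F}(\tau)\to\mathcal{F}(x)$ for every edge $\tau$ and vertex $x\in\tau$. $H_0(X,\mathcal{F})$ is the cokernel of the map $\bigoplus_{\tau\in X^1}\mathcal{F}(\tau)\to\bigoplus_{x\in X^0}\mathcal{F}(x)$ sending $f\in\mathcal{F}(\tau)$ to $\sum_{x\in\tau}r^{\tau}_x(f)$; the natural map $\mathcal{F}(y)\to H_0(X,\mathcal{F})$ is the inclusion of the summand followed by the projection. -}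

module Defs where

open import Level using (Level; _⊔_) renaming (suc to lsuc)
open import Data.Nat using (ℕ; suc; _^_; _≥_)
open import Data.Nat.Primality using (Prime)
open import Data.Fin using (Fin)
import Data.Fin.Properties as FinP
open import Data.List using (List; []; _∷_; _++_)
import Data.List.Properties as ListP
open import Data.Product using (Σ; _,_; _×_; ∃)
open import Relation.Binary.PropositionalEquality using (_≡_; refl; cong₂)
open import Relation.Nullary using (Dec; yes; no; ¬_)
open import Relation.Binary.Definitions using (DecidableEquality)
open import Function.Definitions using (Injective)
open import Algebra.Bundles using (Ring)
open import Algebra.Module.Bundles using (LeftModule)
open import Algebra.Module.Morphism.Structures using (module LeftModuleMorphisms)

-- The residue field size q = p ^ f of a non-archimedean local field F
-- of residue characteristic p.  The Bruhat–Tits tree of PGL₂(F) is the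
-- (q+1)-regular tree; we use the following concrete model of it.
--
-- Vertices: a root, and the non-backtracking paths out of the root,
--   node i js  = the vertex reached by first going to neighbour i
--                (of q+1) of the root and then choosing successively
--                the children listed (innermost choice first) in js
--                (each vertex other than the root has q children).
-- Edges: every edge is {v , parent v} for a unique non-root vertex v;
--   we index edges by that vertex.

module BruhatTits (q : ℕ) where

  data Vertex : Set where
    root : Vertex
    node : Fin (suc q) → List (Fin q) → Vertex

  data Edge : Set where
    edge : Fin (suc q) → List (Fin q) → Edge

  lower : Edge → Vertex
  lower (edge i js) = node i js

  upper : Edge → Vertex
  upper (edge i [])       = root
  upper (edge i (j ∷ js)) = node i js

  data _∈ₑ_ : Vertex → Edge → Set where
    lower∈ : (τ : Edge) → lower τ ∈ₑ τ
    upper∈ : (τ : Edge) → upper τ ∈ₑ τ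

  _≟V_ : DecidableEquality Vertex
  root ≟V root = yes refl
  root ≟V node _ _ = no λ ()
  node _ _ ≟V root = no λ ()
  node i js ≟V node i' js' with i FinP.≟ i' | ListP.≡-dec FinP._≟_ js js'
  ... | yes refl | yes refl = yes refl
  ... | no ne    | _        = no λ { refl → ne refl }
  ... | yes _    | no ne    = no λ { refl → ne refl }

module _ {r ℓr : Level} (Λ : Ring r ℓr) (q : ℕ) where
  open BruhatTits q
  open Ring Λ using () renaming (Carrier to ΛC)

  record CoeffSystem (m ℓm : Level) : Set (r ⊔ ℓr ⊔ lsuc (m ⊔ ℓm)) where
    field
      FV : Vertex → LeftModule Λ m ℓm
      FE : Edge → LeftModule Λ m ℓm
      res : (τ : Edge) (x : Vertex) → x ∈ₑ τ →
            LeftModule.Carrierᴹ (FE τ) → LeftModule.Carrierᴹ (FV x)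
      res-linear : (τ : Edge) (x : Vertex) (p : x ∈ₑ τ) →
        LeftModuleMorphisms.IsLeftModuleHomomorphism
          (LeftModule.rawLeftModule (FE τ)) (LeftModule.rawLeftModule (FV x))
          (res τ x p)

  module _ {m ℓm : Level} (𝓕 : CoeffSystem m ℓm) where
    open CoeffSystem 𝓕

    CV : Vertex → Set m
    CV x = LeftModule.Carrierᴹ (FV x)

    CE : Edge → Set m
    CE τ = LeftModule.Carrierᴹ (FE τ)

    C₀ : Set m
    C₀ = List (Σ Vertex CV)

    C₁ : Set m
    C₁ = List (Σ Edge CE)

    component : (x : Vertex) → C₀ → CV x
    component x [] = LeftModule.0ᴹ (FV x)
    component x ((y , v) ∷ l) with y ≟V x
    ... | yes refl = LeftModule._+ᴹ_ (FV x) v (component x l)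
    ... | no _     = component x l

    ∂ : C₁ → C₀
    ∂ [] = []
    ∂ ((τ , f) ∷ l) =
      (lower τ , res τ (lower τ) (lower∈ τ) f) ∷
      (upper τ , res τ (upper τ) (upper∈ τ) f) ∷ ∂ l

    -- equality in H₀(X,𝓕) = coker ∂ : a and b have the same class iff
    -- a - b = ∂ c for some c
    _≈H₀_ : C₀ → C₀ → Set (m ⊔ ℓm)
    a ≈H₀ b = ∃ λ (c : C₁) → (x : Vertex) →
      LeftModule._≈ᴹ_ (FV x)
        (LeftModule._+ᴹ_ (FV x) (component x a) (LeftModule.-ᴹ_ (FV x) (component x b)))
        (component x (∂ c))

    ι : (y : Vertex) → CV y → C₀
    ι y v = (y , v) ∷ []

    AllTransitionsInjective : Set (m ⊔ ℓm)
    AllTransitionsInjective = (τ : Edge) (x : Vertex) (p : x ∈ₑ τ) →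
      Injective (LeftModule._≈ᴹ_ (FE τ)) (LeftModule._≈ᴹ_ (FV x)) (res τ x p)

    NaturalMapInjective : Vertex → Set (m ⊔ ℓm)
    NaturalMapInjective y = (v w : CV y) → ι y v ≈H₀ ι y w →
      LeftModule._≈ᴹ_ (FV y) v w

    H₀Zero : Set (m ⊔ ℓm)
    H₀Zero = (a : C₀) → a ≈H₀ []

    IsZero : Set (m ⊔ ℓm)
    IsZero = ((x : Vertex) (v : CV x) → LeftModule._≈ᴹ_ (FV x) v (LeftModule.0ᴹ (FV x)))
           × ((τ : Edge) (f : CE τ) → LeftModule._≈ᴹ_ (FE τ) f (LeftModule.0ᴹ (FE τ)))

{-# OPTIONS --safe #-}
-- Fix y and a finite 1-chain c whose boundary vanishes at every vertex
-- other than y; we show that all coefficients of c vanish.  Orient each edge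
-- away from y, so that every vertex x ≠ y is the far endpoint of exactly one
-- edge τ and the near endpoint of all the others.  Take an edge τ of the
-- support whose far endpoint x is as far from y as possible: the other edges
-- at x lie beyond the support, so the x-component of ∂c is just r^τ_x(c_τ),
-- which is 0, and injectivity of r^τ_x gives c_τ = 0.  By descending
-- induction c = 0, so ∂c also vanishes at y.
module Submission where

open import Defs
open import Level using (Level)
open import Data.Nat using (ℕ; _^_; _≥_)
open import Data.Nat.Primality using (Prime)
open import Data.Product using (_×_)
open import Algebra.Bundles using (Ring)

import Level
open import Algebra.Bundles using (CommutativeMonoid)
open import Algebra.Module.Bundles using (LeftModule)
open import Algebra.Module.Morphism.Structures using (module LeftModuleMorphisms)
import Algebra.Properties.CommutativeSemigroup as CommutativeSemigroupProperties
import Algebra.Properties.Group as GroupProperties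
open import Data.Fin.Properties as Fin using ()
open import Data.List using (List; []; _∷_; _++_; length; filter)
open import Data.List.Properties using (≡-dec; length-filter)
open import Data.List.Relation.Binary.Pointwise using (Pointwise-≡⇒≡; Pointwise-length; ≡⇒Pointwise-≡)
open import Data.List.Relation.Binary.Suffix.Heterogeneous using (Suffix; here; there; tail)
open import Data.List.Relation.Binary.Suffix.Heterogeneous.Properties
  using (length-mono; S[as][bs]⇒∣as∣≢1+∣bs∣; suffix?)
open import Data.Nat using (zero; suc; _+_; _∸_; _⊔_; _≤_; _<_; z≤n; s≤s)
open import Data.Nat.Induction using (<-wellFounded)
open import Data.Nat.Properties
  using ( ≤-refl; ≤-trans; ≤-<-trans; <-irrefl; ≤⇒≯; 1+n≰n; n<1+n; m∸n≤m; m≤m+n; m≤n+m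
        ; m≤m⊔n; m≤n⊔m; ∸-monoʳ-<; +-monoʳ-<; +-monoˡ-≤; +-identityʳ; +-suc; module ≤-Reasoning)
open import Data.Product using (_,_)
open import Data.Sum using (_⊎_; inj₁; inj₂)
open import Function using (_∘_; _on_)
open import Induction.WellFounded using (Acc; acc)
import Relation.Binary.Construct.On as On
open import Relation.Binary.Definitions using (Decidable; DecidableEquality)
open import Relation.Binary.PropositionalEquality
  using (_≡_; _≢_; refl; sym; trans; cong; cong₂; subst; subst₂)
import Relation.Binary.Reasoning.Setoid as SetoidReasoning
open import Relation.Nullary using (Dec; yes; no; ¬_; ¬?; contradiction)

suffix-unique : ∀ {a} {A : Set a} {as bs cs : List A} →
  Suffix _≡_ as cs → Suffix _≡_ bs cs → length as ≡ length bs → as ≡ bs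
suffix-unique (here p)  (here p′)  _ = trans (Pointwise-≡⇒≡ p) (sym (Pointwise-≡⇒≡ p′))
suffix-unique (here p)  (there s)  e =
  contradiction (trans (sym e) (Pointwise-length p)) (S[as][bs]⇒∣as∣≢1+∣bs∣ s)
suffix-unique (there s) (here p)   e =
  contradiction (trans e (Pointwise-length p)) (S[as][bs]⇒∣as∣≢1+∣bs∣ s)
suffix-unique (there s) (there s′) e = suffix-unique s s′ e

module _ {q : ℕ} where
  open BruhatTits q

  depth : Vertex → ℕ
  depth root        = 0
  depth (node _ js) = suc (length js)

  depth-upper<lower : ∀ τ → depth (upper τ) < depth (lower τ)
  depth-upper<lower (edge i [])       = s≤s z≤n
  depth-upper<lower (edge i (j ∷ js)) = n<1+n _

  lower≢upper : ∀ τ → lower τ ≢ upper τ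
  lower≢upper τ eq = <-irrefl (cong depth (sym eq)) (depth-upper<lower τ)

  lower-injective : ∀ {τ τ′} → lower τ ≡ lower τ′ → τ ≡ τ′
  lower-injective {edge _ _} {edge _ _} refl = refl

  _≟E_ : DecidableEquality Edge
  edge i js ≟E edge i′ js′ with i Fin.≟ i′ | ≡-dec Fin._≟_ js js′
  ... | yes refl | yes refl  = yes refl
  ... | no i≢i′  | _         = no λ { refl → i≢i′ refl }
  ... | yes _    | no js≢js′ = no λ { refl → js≢js′ refl }

  -- x ≼ y : x lies on the path from the root to y.  Paths are stored
  -- deepest step first, so the ancestors of node i ks are the suffixes.
  data _≼_ : Vertex → Vertex → Set where
    root≼ : ∀ {y} → root ≼ y
    node≼ : ∀ {i js ks} → Suffix _≡_ js ks → node i js ≼ node i ks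

  _≼?_ : Decidable _≼_
  root      ≼? y         = yes root≼
  node i js ≼? root      = no λ ()
  node i js ≼? node k ks with i Fin.≟ k | suffix? Fin._≟_ js ks
  ... | yes refl | yes s = yes (node≼ s)
  ... | yes refl | no ¬s = no λ { (node≼ s) → ¬s s }
  ... | no i≢k   | _     = no λ { (node≼ _) → i≢k refl }

  ≼-refl : ∀ {x} → x ≼ x
  ≼-refl {root}      = root≼
  ≼-refl {node i js} = node≼ (here (≡⇒Pointwise-≡ refl))

  ≼-depth : ∀ {x y} → x ≼ y → depth x ≤ depth y
  ≼-depth root≼     = z≤n
  ≼-depth (node≼ s) = s≤s (length-mono s)

  upper≼ : ∀ τ {y} → lower τ ≼ y → upper τ ≼ y
  upper≼ (edge i [])      _         = root≼
  upper≼ (edge i (_ ∷ _)) (node≼ s) = node≼ (tail s)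

  ≼-child-unique : ∀ {τ τ′ y} → lower τ ≼ y → lower τ′ ≼ y → upper τ ≡ upper τ′ → τ ≡ τ′
  ≼-child-unique {edge _ []}      {edge _ []}      (node≼ _) (node≼ _)  _    = refl
  ≼-child-unique {edge i (_ ∷ _)} {edge _ (_ ∷ _)} (node≼ s) (node≼ s′) refl =
    cong (edge i) (suffix-unique s s′ refl)
  ≼-child-unique {edge _ []}      {edge _ (_ ∷ _)} _ _ ()
  ≼-child-unique {edge _ (_ ∷ _)} {edge _ []}      _ _ ()

  record OrientationTowards (y : Vertex) : Set where
    field
      far near        : Edge → Vertex
      far∈            : ∀ τ → far τ ∈ₑ τ
      far-or-near     : ∀ {x τ} → x ∈ₑ τ → x ≡ far τ ⊎ x ≡ near τ
      far-injective   : ∀ {τ τ′} → far τ ≡ far τ′ → τ ≡ τ′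
      far≢            : ∀ τ → far τ ≢ y
      height          : Vertex → ℕ
      height-near<far : ∀ τ → height (near τ) < height (far τ)

  module Towards (y : Vertex) where

    -- A stand-in for the distance to y: it too increases strictly away from y.
    height : Vertex → ℕ
    height x with x ≼? y
    ... | yes _ = depth y ∸ depth x
    ... | no _  = depth y + depth x

    height-≼ : ∀ {x} → x ≼ y → height x ≡ depth y ∸ depth x
    height-≼ {x} x≼y with x ≼? y
    ... | yes _  = refl
    ... | no x⋠y = contradiction x≼y x⋠y

    height-⋠ : ∀ {x} → ¬ x ≼ y → height x ≡ depth y + depth x
    height-⋠ {x} x⋠y with x ≼? y
    ... | yes x≼y = contradiction x≼y x⋠y
    ... | no _    = refl

    height≤ : ∀ x → height x ≤ depth y + depth x
    height≤ x with x ≼? y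
    ... | yes _ = ≤-trans (m∸n≤m (depth y) (depth x)) (m≤m+n (depth y) (depth x))
    ... | no _  = ≤-refl

    -- Seen from y, an edge on the path from the root to y leads towards the
    -- root and any other edge leads away from it.
    far near : (τ : Edge) → Dec (lower τ ≼ y) → Vertex
    far  τ (yes _) = upper τ
    far  τ (no _)  = lower τ
    near τ (yes _) = lower τ
    near τ (no _)  = upper τ

    far∈ : ∀ τ d → far τ d ∈ₑ τ
    far∈ τ (yes _) = upper∈ τ
    far∈ τ (no _)  = lower∈ τ

    far-or-near : ∀ {x τ} → x ∈ₑ τ → ∀ d → x ≡ far τ d ⊎ x ≡ near τ d
    far-or-near (lower∈ τ) (yes _) = inj₂ refl
    far-or-near (lower∈ τ) (no _)  = inj₁ refl
    far-or-near (upper∈ τ) (yes _) = inj₁ refl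
    far-or-near (upper∈ τ) (no _)  = inj₂ refl

    far-injective : ∀ τ τ′ d d′ → far τ d ≡ far τ′ d′ → τ ≡ τ′
    far-injective τ τ′ (yes a) (yes a′) e = ≼-child-unique a a′ e
    far-injective τ τ′ (no _)  (no _)   e = lower-injective e
    far-injective τ τ′ (yes a) (no ¬a′) e = contradiction (subst (_≼ y) e (upper≼ τ a)) ¬a′
    far-injective τ τ′ (no ¬a) (yes a′) e = contradiction (subst (_≼ y) (sym e) (upper≼ τ′ a′)) ¬a

    far≢ : ∀ τ d → far τ d ≢ y
    far≢ τ (yes a) e = ≤⇒≯ (≼-depth a) (subst (_< depth (lower τ)) (cong depth e) (depth-upper<lower τ))
    far≢ τ (no ¬a) e = ¬a (subst (lower τ ≼_) e ≼-refl)

    height-near<far : ∀ τ d → height (near τ d) < height (far τ d)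
    height-near<far τ (yes a) =
      subst₂ _<_ (sym (height-≼ a)) (sym (height-≼ (upper≼ τ a)))
        (∸-monoʳ-< (depth-upper<lower τ) (≼-depth a))
    height-near<far τ (no ¬a) =
      ≤-<-trans (height≤ (upper τ))
        (subst (depth y + depth (upper τ) <_) (sym (height-⋠ ¬a))
          (+-monoʳ-< (depth y) (depth-upper<lower τ)))

  towards : ∀ y → OrientationTowards y
  towards y = record
    { far             = λ τ → far τ (lower τ ≼? y)
    ; near            = λ τ → near τ (lower τ ≼? y)
    ; far∈            = λ τ → far∈ τ (lower τ ≼? y)
    ; far-or-near     = λ {_} {τ} p → far-or-near p (lower τ ≼? y)
    ; far-injective   = λ {τ} {τ′} → far-injective τ τ′ (lower τ ≼? y) (lower τ′ ≼? y)
    ; far≢            = λ τ → far≢ τ (lower τ ≼? y)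
    ; height          = height
    ; height-near<far = λ τ → height-near<far τ (lower τ ≼? y)
    }
    where open Towards y

module _ {r ℓr m ℓm : Level} {Λ : Ring r ℓr} {q : ℕ} (𝓕 : CoeffSystem Λ q m ℓm) where
  open BruhatTits q
  open CoeffSystem 𝓕

  private
    module V (x : Vertex) = LeftModule (FV x)
    module E (τ : Edge) = LeftModule (FE τ)
    module Res {τ x} (p : x ∈ₑ τ) = LeftModuleMorphisms.IsLeftModuleHomomorphism (res-linear τ x p)

  infix 20 _⟨_⟩
  _⟨_⟩ : C₀ Λ q 𝓕 → (x : Vertex) → CV Λ q 𝓕 x
  a ⟨ x ⟩ = component Λ q 𝓕 x a

  δ : C₁ Λ q 𝓕 → C₀ Λ q 𝓕
  δ = ∂ Λ q 𝓕

  module _ {x : Vertex} where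
    open LeftModule (FV x)

    component-here : ∀ u a → ((x , u) ∷ a) ⟨ x ⟩ ≡ u +ᴹ a ⟨ x ⟩
    component-here u a with x ≟V x
    ... | yes refl = refl
    ... | no x≢x   = contradiction refl x≢x

    component-elsewhere : ∀ {z} u a → z ≢ x → ((z , u) ∷ a) ⟨ x ⟩ ≡ a ⟨ x ⟩
    component-elsewhere {z} u a z≢x with z ≟V x
    ... | yes refl = contradiction refl z≢x
    ... | no _     = refl

    component-single : ∀ u → ((x , u) ∷ []) ⟨ x ⟩ ≈ᴹ u
    component-single u = ≈ᴹ-trans (≈ᴹ-reflexive (component-here u [])) (+ᴹ-identityʳ u)

    component-++ : ∀ a b → (a ++ b) ⟨ x ⟩ ≈ᴹ a ⟨ x ⟩ +ᴹ b ⟨ x ⟩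
    component-++ []             b = ≈ᴹ-sym (+ᴹ-identityˡ _)
    component-++ ((z , u) ∷ a) b with z ≟V x
    ... | yes refl = ≈ᴹ-trans (+ᴹ-congˡ (component-++ a b)) (≈ᴹ-sym (+ᴹ-assoc _ _ _))
    ... | no _     = component-++ a b

    component-first : ∀ {z} u v → z ≢ x → ((x , u) ∷ (z , v) ∷ []) ⟨ x ⟩ ≈ᴹ u
    component-first {z} u v z≢x = ≈ᴹ-trans
      (≈ᴹ-reflexive (trans (component-here u _) (cong (u +ᴹ_) (component-elsewhere v [] z≢x))))
      (+ᴹ-identityʳ u)

    component-second : ∀ {z} u v → z ≢ x → ((z , u) ∷ (x , v) ∷ []) ⟨ x ⟩ ≈ᴹ v
    component-second {z} u v z≢x = ≈ᴹ-trans
      (≈ᴹ-reflexive (trans (component-elsewhere u _ z≢x) (component-here v [])))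
      (+ᴹ-identityʳ v)

    component-single-0ᴹ : ∀ z → ((z , V.0ᴹ z) ∷ []) ⟨ x ⟩ ≈ᴹ 0ᴹ
    component-single-0ᴹ z with z ≟V x
    ... | yes refl = +ᴹ-identityʳ 0ᴹ
    ... | no _     = ≈ᴹ-refl

  ∂-entry : (x : Vertex) (τ : Edge) → CE Λ q 𝓕 τ → CV Λ q 𝓕 x
  ∂-entry x τ f = δ ((τ , f) ∷ []) ⟨ x ⟩

  ∂-entry-∈ : ∀ {x τ} (p : x ∈ₑ τ) f → V._≈ᴹ_ x (∂-entry x τ f) (res τ x p f)
  ∂-entry-∈ (lower∈ τ) f = component-first _ _ (lower≢upper τ ∘ sym)
  ∂-entry-∈ (upper∈ τ) f = component-second _ _ (lower≢upper τ)

  data ∂-EntryView (x : Vertex) (τ : Edge) : Set (m Level.⊔ ℓm) where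
    incident : (p : x ∈ₑ τ) → (∀ f → V._≈ᴹ_ x (∂-entry x τ f) (res τ x p f)) → ∂-EntryView x τ
    apart    : (∀ f → ∂-entry x τ f ≡ V.0ᴹ x) → ∂-EntryView x τ

  ∂-entry-view : ∀ x τ → ∂-EntryView x τ
  ∂-entry-view x τ = view (lower τ ≟V x) (upper τ ≟V x)
    where
    view : Dec (lower τ ≡ x) → Dec (upper τ ≡ x) → ∂-EntryView x τ
    view (yes refl) _          = incident (lower∈ τ) (∂-entry-∈ (lower∈ τ))
    view (no _)     (yes refl) = incident (upper∈ τ) (∂-entry-∈ (upper∈ τ))
    view (no l≢x)   (no u≢x)   = apart λ f →
      trans (component-elsewhere _ _ l≢x) (component-elsewhere _ [] u≢x)

  module _ {x : Vertex} where
    open LeftModule (FV x)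

    ∂-entry-+ : ∀ τ f g → ∂-entry x τ (E._+ᴹ_ τ f g) ≈ᴹ ∂-entry x τ f +ᴹ ∂-entry x τ g
    ∂-entry-+ τ f g with ∂-entry-view x τ
    ... | incident p e = ≈ᴹ-trans (e _)
      (≈ᴹ-trans (Res.+ᴹ-homo p f g) (≈ᴹ-sym (+ᴹ-cong (e f) (e g))))
    ... | apart z = ≈ᴹ-trans (≈ᴹ-reflexive (z _))
      (≈ᴹ-sym (≈ᴹ-trans (+ᴹ-cong (≈ᴹ-reflexive (z f)) (≈ᴹ-reflexive (z g))) (+ᴹ-identityʳ 0ᴹ)))

    ∂-entry-vanishes : ∀ τ {f} → (x ∈ₑ τ → E._≈ᴹ_ τ f (E.0ᴹ τ)) → ∂-entry x τ f ≈ᴹ 0ᴹ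
    ∂-entry-vanishes τ {f} f≈0 with ∂-entry-view x τ
    ... | incident p e = ≈ᴹ-trans (e f) (≈ᴹ-trans (Res.⟦⟧-cong p (f≈0 p)) (Res.0ᴹ-homo p))
    ... | apart z      = ≈ᴹ-reflexive (z f)

  -- A chain may list an edge several times; coeff collects those terms.
  coeff : (τ : Edge) → C₁ Λ q 𝓕 → CE Λ q 𝓕 τ
  coeff τ []            = E.0ᴹ τ
  coeff τ ((σ , f) ∷ c) with σ ≟E τ
  ... | yes refl = E._+ᴹ_ τ f (coeff τ c)
  ... | no _     = coeff τ c

  erase : Edge → C₁ Λ q 𝓕 → C₁ Λ q 𝓕
  erase τ = filter λ (σ , _) → ¬? (σ ≟E τ)

  _∉supp_ : Edge → C₁ Λ q 𝓕 → Set ℓm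
  τ ∉supp c = E._≈ᴹ_ τ (coeff τ c) (E.0ᴹ τ)

  coeff-here : ∀ {τ} f c → coeff τ ((τ , f) ∷ c) ≡ E._+ᴹ_ τ f (coeff τ c)
  coeff-here {τ} f c with τ ≟E τ
  ... | yes refl = refl
  ... | no τ≢τ   = contradiction refl τ≢τ

  coeff-elsewhere : ∀ {σ τ} f c → σ ≢ τ → coeff τ ((σ , f) ∷ c) ≡ coeff τ c
  coeff-elsewhere {σ} {τ} f c σ≢τ with σ ≟E τ
  ... | yes refl = contradiction refl σ≢τ
  ... | no _     = refl

  erase-shorter : ∀ τ f c → length (erase τ ((τ , f) ∷ c)) < length ((τ , f) ∷ c)
  erase-shorter τ f c with τ ≟E τ
  ... | yes _   = s≤s (length-filter _ c)
  ... | no τ≢τ  = contradiction refl τ≢τ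

  erase-∉supp : ∀ τ c → τ ∉supp erase τ c
  erase-∉supp τ []            = E.≈ᴹ-refl τ
  erase-∉supp τ ((σ , f) ∷ c) with σ ≟E τ
  ... | yes refl = erase-∉supp τ c
  ... | no σ≢τ   = E.≈ᴹ-trans τ (E.≈ᴹ-reflexive τ (coeff-elsewhere f _ σ≢τ)) (erase-∉supp τ c)

  coeff-erase : ∀ {σ τ} c → σ ≢ τ → E._≈ᴹ_ σ (coeff σ (erase τ c)) (coeff σ c)
  coeff-erase {σ} {τ} []             _   = E.≈ᴹ-refl σ
  coeff-erase {σ} {τ} ((ρ , f) ∷ c) σ≢τ with ρ ≟E τ
  ... | yes refl =
    E.≈ᴹ-trans σ (coeff-erase c σ≢τ) (E.≈ᴹ-reflexive σ (sym (coeff-elsewhere f c (σ≢τ ∘ sym))))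
  ... | no _ with ρ ≟E σ
  ...   | yes refl = E.+ᴹ-congˡ σ (coeff-erase c σ≢τ)
  ...   | no _     = coeff-erase c σ≢τ

  erase-preserves-∉supp : ∀ τ c {σ} → (σ ≢ τ → σ ∉supp c) → σ ∉supp erase τ c
  erase-preserves-∉supp τ c {σ} σ∉c with σ ≟E τ
  ... | yes refl = erase-∉supp τ c
  ... | no σ≢τ   = E.≈ᴹ-trans σ (coeff-erase c σ≢τ) (σ∉c σ≢τ)

  module _ {x : Vertex} where
    open LeftModule (FV x)
    open SetoidReasoning ≈ᴹ-setoid
    open CommutativeSemigroupProperties (CommutativeMonoid.commutativeSemigroup +ᴹ-commutativeMonoid)
      using (x∙yz≈y∙xz)

    component-∂-cons : ∀ σ f c → δ ((σ , f) ∷ c) ⟨ x ⟩ ≈ᴹ ∂-entry x σ f +ᴹ δ c ⟨ x ⟩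
    component-∂-cons σ f c = component-++ (δ ((σ , f) ∷ [])) (δ c)

    component-∂-split : ∀ τ c → δ c ⟨ x ⟩ ≈ᴹ ∂-entry x τ (coeff τ c) +ᴹ δ (erase τ c) ⟨ x ⟩
    component-∂-split τ [] =
      ≈ᴹ-sym (≈ᴹ-trans (+ᴹ-congʳ (∂-entry-vanishes τ λ _ → E.≈ᴹ-refl τ)) (+ᴹ-identityˡ 0ᴹ))
    component-∂-split τ ((σ , f) ∷ c) with σ ≟E τ
    ... | yes refl = begin
      δ ((τ , f) ∷ c) ⟨ x ⟩
        ≈⟨ component-∂-cons τ f c ⟩
      ∂-entry x τ f +ᴹ δ c ⟨ x ⟩
        ≈⟨ +ᴹ-congˡ (component-∂-split τ c) ⟩
      ∂-entry x τ f +ᴹ (∂-entry x τ (coeff τ c) +ᴹ δ (erase τ c) ⟨ x ⟩)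
        ≈⟨ +ᴹ-assoc _ _ _ ⟨
      ∂-entry x τ f +ᴹ ∂-entry x τ (coeff τ c) +ᴹ δ (erase τ c) ⟨ x ⟩
        ≈⟨ +ᴹ-congʳ (∂-entry-+ τ f (coeff τ c)) ⟨
      ∂-entry x τ (E._+ᴹ_ τ f (coeff τ c)) +ᴹ δ (erase τ c) ⟨ x ⟩ ∎
    ... | no _ = begin
      δ ((σ , f) ∷ c) ⟨ x ⟩
        ≈⟨ component-∂-cons σ f c ⟩
      ∂-entry x σ f +ᴹ δ c ⟨ x ⟩
        ≈⟨ +ᴹ-congˡ (component-∂-split τ c) ⟩
      ∂-entry x σ f +ᴹ (∂-entry x τ (coeff τ c) +ᴹ δ (erase τ c) ⟨ x ⟩)
        ≈⟨ x∙yz≈y∙xz _ _ _ ⟩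
      ∂-entry x τ (coeff τ c) +ᴹ (∂-entry x σ f +ᴹ δ (erase τ c) ⟨ x ⟩)
        ≈⟨ +ᴹ-congˡ (component-∂-cons σ f (erase τ c)) ⟨
      ∂-entry x τ (coeff τ c) +ᴹ δ ((σ , f) ∷ erase τ c) ⟨ x ⟩ ∎

    component-∂-vanishes : ∀ c → (∀ τ → x ∈ₑ τ → τ ∉supp c) → δ c ⟨ x ⟩ ≈ᴹ 0ᴹ
    component-∂-vanishes c = go c (On.wellFounded length <-wellFounded c)
      where
      go : ∀ c → Acc (_<_ on length) c → (∀ τ → x ∈ₑ τ → τ ∉supp c) → δ c ⟨ x ⟩ ≈ᴹ 0ᴹ
      go []            _         _   = ≈ᴹ-refl
      go ((τ , f) ∷ c) (acc rec) c∉ = begin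
        δ ((τ , f) ∷ c) ⟨ x ⟩                           ≈⟨ component-∂-split τ ((τ , f) ∷ c) ⟩
        ∂-entry x τ (coeff τ ((τ , f) ∷ c)) +ᴹ δ (erase τ ((τ , f) ∷ c)) ⟨ x ⟩
          ≈⟨ +ᴹ-cong (∂-entry-vanishes τ (c∉ τ))
                     (go (erase τ ((τ , f) ∷ c)) (rec (erase-shorter τ f c))
                        λ σ p → erase-preserves-∉supp τ ((τ , f) ∷ c) λ _ → c∉ σ p) ⟩
        0ᴹ +ᴹ 0ᴹ                                        ≈⟨ +ᴹ-identityʳ 0ᴹ ⟩
        0ᴹ                                              ∎

    component-∂-local : ∀ τ c → (∀ σ → x ∈ₑ σ → σ ≢ τ → σ ∉supp c) →
                        δ c ⟨ x ⟩ ≈ᴹ ∂-entry x τ (coeff τ c)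
    component-∂-local τ c others∉ = begin
      δ c ⟨ x ⟩                                            ≈⟨ component-∂-split τ c ⟩
      ∂-entry x τ (coeff τ c) +ᴹ δ (erase τ c) ⟨ x ⟩
        ≈⟨ +ᴹ-congˡ (component-∂-vanishes (erase τ c)
                       λ σ p → erase-preserves-∉supp τ c (others∉ σ p)) ⟩
      ∂-entry x τ (coeff τ c) +ᴹ 0ᴹ                        ≈⟨ +ᴹ-identityʳ _ ⟩
      ∂-entry x τ (coeff τ c)                              ∎

    lone-edge-∉supp : AllTransitionsInjective Λ q 𝓕 → ∀ {τ} (p : x ∈ₑ τ) c → δ c ⟨ x ⟩ ≈ᴹ 0ᴹ →
                      (∀ σ → x ∈ₑ σ → σ ≢ τ → σ ∉supp c) → τ ∉supp c
    lone-edge-∉supp inj {τ} p c δc≈0 others∉ = inj τ x p (begin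
      res τ x p (coeff τ c)   ≈⟨ ∂-entry-∈ p (coeff τ c) ⟨
      ∂-entry x τ (coeff τ c) ≈⟨ component-∂-local τ c others∉ ⟨
      δ c ⟨ x ⟩               ≈⟨ δc≈0 ⟩
      0ᴹ                      ≈⟨ Res.0ᴹ-homo p ⟨
      res τ x p (E.0ᴹ τ)      ∎)

  module Descent (inj : AllTransitionsInjective Λ q 𝓕) {y : Vertex} (o : OrientationTowards y)
                 (c : C₁ Λ q 𝓕) (δc-off-y : ∀ x → x ≢ y → V._≈ᴹ_ x (δ c ⟨ x ⟩) (V.0ᴹ x)) where
    open OrientationTowards o

    bound : C₁ Λ q 𝓕 → ℕ
    bound []            = 0
    bound ((τ , _) ∷ d) = suc (height (far τ)) ⊔ bound d

    ∉supp-beyond-bound : ∀ τ d → bound d ≤ height (far τ) → τ ∉supp d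
    ∉supp-beyond-bound τ []            _  = E.≈ᴹ-refl τ
    ∉supp-beyond-bound τ ((σ , f) ∷ d) b≤ with σ ≟E τ
    ... | yes refl = contradiction (≤-trans (m≤m⊔n _ (bound d)) b≤) 1+n≰n
    ... | no _     = ∉supp-beyond-bound τ d (≤-trans (m≤n⊔m _ (bound d)) b≤)

    ∉supp-from : ∀ k τ → bound c ≤ height (far τ) + k → τ ∉supp c
    ∉supp-from zero    τ b≤ = ∉supp-beyond-bound τ c (subst (bound c ≤_) (+-identityʳ _) b≤)
    ∉supp-from (suc k) τ b≤ = lone-edge-∉supp inj (far∈ τ) c (δc-off-y (far τ) (far≢ τ)) others∉
      where
      others∉ : ∀ σ → far τ ∈ₑ σ → σ ≢ τ → σ ∉supp c
      others∉ σ p σ≢τ with far-or-near p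
      ... | inj₁ e = contradiction (far-injective (sym e)) σ≢τ
      ... | inj₂ e = ∉supp-from k σ (begin
        bound c                  ≤⟨ b≤ ⟩
        height (far τ) + suc k   ≡⟨ +-suc _ k ⟩
        suc (height (far τ)) + k ≤⟨ +-monoˡ-≤ k far-τ<far-σ ⟩
        height (far σ) + k       ∎)
        where
        open ≤-Reasoning
        far-τ<far-σ : height (far τ) < height (far σ)
        far-τ<far-σ = subst (λ v → height v < height (far σ)) (sym e) (height-near<far σ)

    all-∉supp : ∀ τ → τ ∉supp c
    all-∉supp τ = ∉supp-from (bound c) τ (m≤n+m (bound c) (height (far τ)))

  ∂-vanishing-off⇒vanishing-at : AllTransitionsInjective Λ q 𝓕 → ∀ y c →
    (∀ x → x ≢ y → V._≈ᴹ_ x (δ c ⟨ x ⟩) (V.0ᴹ x)) → V._≈ᴹ_ y (δ c ⟨ y ⟩) (V.0ᴹ y)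
  ∂-vanishing-off⇒vanishing-at inj y c δc-off-y =
    component-∂-vanishes c λ τ _ → Descent.all-∉supp inj (towards y) c δc-off-y τ

  natural-map-injective : AllTransitionsInjective Λ q 𝓕 → ∀ y → NaturalMapInjective Λ q 𝓕 y
  natural-map-injective inj y v w (c , hc) = x∙y⁻¹≈ε⇒x≈y v w (begin
    v +ᴹ -ᴹ w
      ≈⟨ +ᴹ-cong (component-single v) (-ᴹ‿cong (component-single w)) ⟨
    ι Λ q 𝓕 y v ⟨ y ⟩ +ᴹ -ᴹ ι Λ q 𝓕 y w ⟨ y ⟩ ≈⟨ hc y ⟩
    δ c ⟨ y ⟩                                     ≈⟨ ∂-vanishing-off⇒vanishing-at inj y c δc-off-y ⟩
    0ᴹ                                            ∎)
    where
    open LeftModule (FV y)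
    open SetoidReasoning ≈ᴹ-setoid
    open GroupProperties +ᴹ-group using (x∙y⁻¹≈ε⇒x≈y)
    δc-off-y : ∀ x → x ≢ y → V._≈ᴹ_ x (δ c ⟨ x ⟩) (V.0ᴹ x)
    δc-off-y x x≢y = V.≈ᴹ-trans x (V.≈ᴹ-sym x (hc x)) (V.≈ᴹ-trans x
      (V.≈ᴹ-reflexive x (cong₂ (λ a b → V._+ᴹ_ x a (V.-ᴹ_ x b))
        (component-elsewhere v [] (x≢y ∘ sym)) (component-elsewhere w [] (x≢y ∘ sym))))
      (V.-ᴹ‿inverseʳ x (V.0ᴹ x)))

  H₀-zero⇒zero : AllTransitionsInjective Λ q 𝓕 → H₀Zero Λ q 𝓕 → IsZero Λ q 𝓕
  H₀-zero⇒zero inj h₀ = vertex-zero , edge-zero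
    where
    vertex-zero : ∀ x v → V._≈ᴹ_ x v (V.0ᴹ x)
    vertex-zero x v with h₀ (ι Λ q 𝓕 x v)
    ... | c , hc = natural-map-injective inj x v (V.0ᴹ x)
      (c , λ z → V.≈ᴹ-trans z (V.+ᴹ-congˡ z (V.-ᴹ‿cong z (component-single-0ᴹ x))) (hc z))
    edge-zero : ∀ τ f → E._≈ᴹ_ τ f (E.0ᴹ τ)
    edge-zero τ f = inj τ (lower τ) (lower∈ τ)
      (V.≈ᴹ-trans (lower τ) (vertex-zero (lower τ) _) (V.≈ᴹ-sym (lower τ) (Res.0ᴹ-homo (lower∈ τ))))

lemma2p1 : {r ℓr m ℓm : Level} (Λ : Ring r ℓr) (p f : ℕ) → Prime p → f ≥ 1 →
    (𝓕 : CoeffSystem Λ (p ^ f) m ℓm) →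
    AllTransitionsInjective Λ (p ^ f) 𝓕 →
    ((y : BruhatTits.Vertex (p ^ f)) → NaturalMapInjective Λ (p ^ f) 𝓕 y)
    × (H₀Zero Λ (p ^ f) 𝓕 → IsZero Λ (p ^ f) 𝓕)
lemma2p1 Λ p f _ _ 𝓕 inj = natural-map-injective 𝓕 inj , H₀-zero⇒zero 𝓕 inj
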